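{- Let $G$ be a simple, connected and finite graph of order $n$, and let $X$ be a total independent set of $G$ of maximum size $\alpha''(G)$. Then the number $e$ of edges contained in $X$ satisfies $\alpha''(G)-\alpha(G) \leq e \leq n - \alpha''(G)$.
   Context: Two vertices are adjacent if they are joined by an edge; two edges are adjacent if they share an end vertex; a vertex and an edge are adjacent if the vertex is an end vertex of the edge. $\alpha(G)$ is the maximum size of a set of pairwise non-adjacent vertices. A total independent set is a subset of $V(G)\cup E(G)$ whose elements are pairwise non-adjacent, and $\alpha''(G)$ is the maximum size of a total independent set. -}

module Defs where


open import Data.Nat using (ℕ; zero; suc; _+_; _<_; _≤_)
open import Data.Bool using (Bool; true; false; if_then_else_)
open import Data.Fin using (Fin; toℕ)
  renaming (zero to fzero; suc to fsuc)
open import Data.Product using (_×_; Σ)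
open import Data.Sum using (_⊎_)
open import Relation.Nullary using (¬_)
open import Relation.Binary.PropositionalEquality using (_≡_)

record Graph (n : ℕ) : Set where
  field
    Adj     : Fin n → Fin n → Bool
    sym     : ∀ u v → Adj u v ≡ Adj v u
    irrefl  : ∀ v → Adj v v ≡ false
open Graph public

data Walk {n : ℕ} (G : Graph n) : Fin n → Fin n → Set where
  here : ∀ {u} → Walk G u u
  step : ∀ {u w v} → Adj G u w ≡ true → Walk G w v → Walk G u v

Connected : ∀ {n} → Graph n → Set
Connected {n} G = ∀ (u v : Fin n) → Walk G u v

count : ∀ {n} → (Fin n → Bool) → ℕ
count {zero}  f = 0
count {suc n} f = (if f fzero then 1 else 0) + count (λ i → f (fsuc i))

VSet : ℕ → Set
VSet n = Fin n → Bool

IsIndependent : ∀ {n} → Graph n → VSet n → Set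
IsIndependent {n} G S =
  ∀ (u v : Fin n) → S u ≡ true → S v ≡ true → Adj G u v ≡ false

IsIndependenceNumber : ∀ {n} → Graph n → ℕ → Set
IsIndependenceNumber {n} G a =
  (Σ (VSet n) λ S → IsIndependent G S × count S ≡ a)
  × (∀ (S : VSet n) → IsIndependent G S → count S ≤ a)

-- A subset of V(G) ∪ E(G): a vertex selector and an edge selector.
-- The edge {i,j} (i ≠ j) is represented by the ordered pair (i , j) with
-- toℕ i < toℕ j; the edge selector may only select such pairs that are edges.
record TotalSet (n : ℕ) : Set where
  field
    vsel : Fin n → Bool
    esel : Fin n → Fin n → Bool
open TotalSet public

ShareEnd : ∀ {n} → Fin n → Fin n → Fin n → Fin n → Set
ShareEnd i j k l = i ≡ k ⊎ i ≡ l ⊎ j ≡ k ⊎ j ≡ l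

IsTotalIndependent : ∀ {n} → Graph n → TotalSet n → Set
IsTotalIndependent {n} G X =
  (∀ (i j : Fin n) → esel X i j ≡ true → (toℕ i < toℕ j) × (Adj G i j ≡ true))
  × (∀ (u v : Fin n) → vsel X u ≡ true → vsel X v ≡ true → Adj G u v ≡ false)
  × (∀ (i j k l : Fin n) → esel X i j ≡ true → esel X k l ≡ true →
       ¬ (i ≡ k × j ≡ l) → ¬ ShareEnd i j k l)
  × (∀ (v i j : Fin n) → vsel X v ≡ true → esel X i j ≡ true →
       ¬ (v ≡ i) × ¬ (v ≡ j))


numEdges : ∀ {n} → TotalSet n → ℕ
numEdges {n} X = sumF (λ i → count (λ j → esel X i j))
  where
  sumF : ∀ {m} → (Fin m → ℕ) → ℕ
  sumF {zero} f = 0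
  sumF {suc m} f = f fzero + sumF (λ i → f (fsuc i))

totalSize : ∀ {n} → TotalSet n → ℕ
totalSize X = count (vsel X) + numEdges X

-- The vertices of X form an independent set of G, so |X| − e ≤ α(G). The edges of X
-- form a matching whose 2e end vertices are distinct from each other and from the
-- vertices of X, so every vertex of G is covered at most once and |X| + e ≤ n.
module Submission where

open import Defs hiding (sym)
open import Data.Bool using (Bool; true; false; if_then_else_)
open import Data.Empty using (⊥-elim)
open import Data.Fin using (Fin; _≟_) renaming (zero to fzero; suc to fsuc)
open import Data.Fin.Properties using (suc-injective; 0≢1+n)
open import Data.Nat using (ℕ; zero; suc; _+_; _≤_; z≤n)
open import Data.Nat.Properties
  using (≤-refl; +-mono-≤; +-comm; +-identityʳ; <-irrefl; +-0-commutativeMonoid)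
open import Algebra.Properties.CommutativeMonoid.Sum +-0-commutativeMonoid
  using (sum; sum-cong-≗; ∑-distrib-+; ∑-comm)
open import Data.Product using (_×_; _,_; proj₁; proj₂; ∃)
open import Data.Sum using (_⊎_; inj₁; inj₂)
open import Relation.Nullary using (¬_; yes; no)
open import Relation.Binary.PropositionalEquality
  using (_≡_; _≢_; refl; sym; trans; cong; cong₂; subst; module ≡-Reasoning)

indicator : Bool → ℕ
indicator b = if b then 1 else 0

count≡sum : ∀ {m} (f : Fin m → Bool) → count f ≡ sum (λ i → indicator (f i))
count≡sum {zero}  f = refl
count≡sum {suc m} f = cong (indicator (f fzero) +_) (count≡sum (λ i → f (fsuc i)))

-- numEdges sums with a function local to its where block, which cannot be named.
-- numEdgesSum is that function, recovered by unification; the with-abstractions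
-- turn the unification problem into pattern form.
private
  mutual
    numEdgesSum : ∀ {k} → TotalSet k → ∀ {m} → (Fin m → ℕ) → ℕ
    numEdgesSum = _

    numEdges-suc : ∀ {n} (X : TotalSet (suc n)) →
      numEdges X ≡ count (esel X fzero) + numEdgesSum X (λ i → count (esel X (fsuc i)))
    numEdges-suc {n} X with count (esel X fzero) | (λ i → count (esel X (fsuc i)))
    ... | _ | _ with suc n
    ... | _ = refl

  numEdgesSum≡sum : ∀ {k} (X : TotalSet k) {m} (f : Fin m → ℕ) → numEdgesSum X f ≡ sum f
  numEdgesSum≡sum X {zero}  f = refl
  numEdgesSum≡sum X {suc m} f = cong (f fzero +_) (numEdgesSum≡sum X (λ i → f (fsuc i)))

numEdges≡sum : ∀ {n} (X : TotalSet n) → numEdges X ≡ sum (λ i → count (esel X i))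
numEdges≡sum {zero}  X = refl
numEdges≡sum {suc n} X =
  trans (numEdges-suc X)
        (cong (count (esel X fzero) +_) (numEdgesSum≡sum X (λ i → count (esel X (fsuc i)))))

sum≤length : ∀ {m} (f : Fin m → ℕ) → (∀ i → f i ≤ 1) → sum f ≤ m
sum≤length {zero}  f f≤1 = z≤n
sum≤length {suc m} f f≤1 = +-mono-≤ (f≤1 fzero) (sum≤length (λ i → f (fsuc i)) (λ i → f≤1 (fsuc i)))

AtMostOne : ∀ {m} → (Fin m → Bool) → Set
AtMostOne {m} f = ∀ (i j : Fin m) → f i ≡ true → f j ≡ true → i ≡ j

count≡0 : ∀ {m} (f : Fin m → Bool) → (∀ i → f i ≢ true) → count f ≡ 0
count≡0 {zero}  f none = refl
count≡0 {suc m} f none with f fzero in f0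
... | true  = ⊥-elim (none fzero f0)
... | false = count≡0 (λ i → f (fsuc i)) (λ i → none (fsuc i))

count≡0⊎witness : ∀ {m} (f : Fin m → Bool) → count f ≡ 0 ⊎ ∃ λ i → f i ≡ true
count≡0⊎witness {zero}  f = inj₁ refl
count≡0⊎witness {suc m} f with f fzero in f0
... | true  = inj₂ (fzero , f0)
... | false with count≡0⊎witness (λ i → f (fsuc i))
...   | inj₁ count≡0       = inj₁ count≡0
...   | inj₂ (i , fsuc-i) = inj₂ (fsuc i , fsuc-i)

count≤1 : ∀ {m} (f : Fin m → Bool) → AtMostOne f → count f ≤ 1
count≤1 {zero}  f unique = z≤n
count≤1 {suc m} f unique with f fzero in f0
... | true  rewrite count≡0 (λ i → f (fsuc i)) (λ i fsuc-i → 0≢1+n (unique fzero (fsuc i) f0 fsuc-i)) = ≤-refl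
... | false = count≤1 (λ i → f (fsuc i)) (λ i j fi fj → suc-injective (unique (fsuc i) (fsuc j) fi fj))

count+count≤1 : ∀ {m} (f g : Fin m → Bool) → AtMostOne f → AtMostOne g →
  (∀ i j → f i ≡ true → g j ≢ true) → count f + count g ≤ 1
count+count≤1 f g unique-f unique-g disjoint with count≡0⊎witness f
... | inj₁ count-f≡0 rewrite count-f≡0 = count≤1 g unique-g
... | inj₂ (i , fi) rewrite count≡0 g (λ j → disjoint i j fi) | +-identityʳ (count f) = count≤1 f unique-f

module _ {n : ℕ} (X : TotalSet n) where

  edgesFrom edgesInto : Fin n → Fin n → Bool
  edgesFrom v j = esel X v j
  edgesInto v i = esel X i v

  coverage : Fin n → ℕ
  coverage v = indicator (vsel X v) + count (edgesFrom v) + count (edgesInto v)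

  sum-coverage : sum coverage ≡ count (vsel X) + numEdges X + numEdges X
  sum-coverage = begin
    sum coverage
      ≡⟨ ∑-distrib-+ (λ v → indicator (vsel X v) + count (edgesFrom v)) (λ v → count (edgesInto v)) ⟩
    sum (λ v → indicator (vsel X v) + count (edgesFrom v)) + sum (λ v → count (edgesInto v))
      ≡⟨ cong₂ _+_ (∑-distrib-+ (λ v → indicator (vsel X v)) (λ v → count (edgesFrom v))) edgesInto-total ⟩
    sum (λ v → indicator (vsel X v)) + sum (λ v → count (edgesFrom v)) + sum (λ v → count (edgesFrom v))
      ≡⟨ cong (λ s → s + E + E) (sym (count≡sum (vsel X))) ⟩
    count (vsel X) + E + E
      ≡⟨ cong (λ e → count (vsel X) + e + e) (sym (numEdges≡sum X)) ⟩
    count (vsel X) + numEdges X + numEdges X ∎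
    where
    open ≡-Reasoning
    E : ℕ
    E = sum (λ v → count (edgesFrom v))
    edgesInto-total : sum (λ v → count (edgesInto v)) ≡ E
    edgesInto-total = begin
      sum (λ v → count (edgesInto v))                 ≡⟨ sum-cong-≗ (λ v → count≡sum (edgesInto v)) ⟩
      sum (λ v → sum (λ i → indicator (esel X i v)))  ≡⟨ ∑-comm (λ v i → indicator (esel X i v)) ⟩
      sum (λ i → sum (λ v → indicator (esel X i v)))  ≡⟨ sum-cong-≗ (λ i → sym (count≡sum (edgesFrom i))) ⟩
      E                                               ∎

module _ {n : ℕ} (G : Graph n) {X : TotalSet n} (X-indep : IsTotalIndependent G X) where
  private
    canonical = proj₁ X-indep
    edges-disjoint = proj₁ (proj₂ (proj₂ X-indep))
    vertex-edge-disjoint = proj₂ (proj₂ (proj₂ X-indep))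

  edgesFrom-atMostOne : ∀ v → AtMostOne (edgesFrom X v)
  edgesFrom-atMostOne v j j' vj vj' with j ≟ j'
  ... | yes j≡j' = j≡j'
  ... | no  j≢j' = ⊥-elim (edges-disjoint v j v j' vj vj' (λ (_ , j≡j') → j≢j' j≡j') (inj₁ refl))

  edgesInto-atMostOne : ∀ v → AtMostOne (edgesInto X v)
  edgesInto-atMostOne v i i' iv i'v with i ≟ i'
  ... | yes i≡i' = i≡i'
  ... | no  i≢i' = ⊥-elim (edges-disjoint i v i' v iv i'v (λ (i≡i' , _) → i≢i' i≡i')
                                          (inj₂ (inj₂ (inj₂ refl))))

  edgesFrom-edgesInto-disjoint : ∀ v j i → edgesFrom X v j ≡ true → edgesInto X v i ≢ true
  edgesFrom-edgesInto-disjoint v j i vj iv = edges-disjoint v j i v vj iv not-same (inj₂ (inj₁ refl))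
    where
    not-same : ¬ (v ≡ i × j ≡ v)
    not-same (refl , refl) = <-irrefl refl (proj₁ (canonical v v vj))

  coverage≤1 : ∀ v → coverage X v ≤ 1
  coverage≤1 v with vsel X v in v∈X
  ... | true  rewrite count≡0 (edgesFrom X v) (λ j vj → proj₁ (vertex-edge-disjoint v v j v∈X vj) refl)
                    | count≡0 (edgesInto X v) (λ i iv → proj₂ (vertex-edge-disjoint v i v v∈X iv) refl)
                    = ≤-refl
  ... | false = count+count≤1 (edgesFrom X v) (edgesInto X v)
                  (edgesFrom-atMostOne v) (edgesInto-atMostOne v) (edgesFrom-edgesInto-disjoint v)

  vertices+2·edges≤n : count (vsel X) + numEdges X + numEdges X ≤ n
  vertices+2·edges≤n = subst (_≤ n) (sum-coverage X) (sum≤length (coverage X) coverage≤1)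

mainTheorem4 : ∀ (n : ℕ) (G : Graph n) → Connected G →
    ∀ (X : TotalSet n) → IsTotalIndependent G X →
    (∀ (Y : TotalSet n) → IsTotalIndependent G Y → totalSize Y ≤ totalSize X) →
    ∀ (a : ℕ) → IsIndependenceNumber G a →
    (totalSize X ≤ a + numEdges X) × (numEdges X + totalSize X ≤ n)
mainTheorem4 n G _ X X-indep _ a (_ , α-maximum) =
  +-mono-≤ (α-maximum (vsel X) (proj₁ (proj₂ X-indep))) ≤-refl ,
  subst (_≤ n) (+-comm (totalSize X) (numEdges X)) (vertices+2·edges≤n G X-indep)
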